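{- Let $b\ge1$ and $n\ge1$. If $A=C_{i_1}\cdots C_{i_n}$ is a juggling card sequence whose $n$ cards are chosen independently and uniformly at random from $\{C_1,\dots,C_b\}$, then the probability that $\pi_A$ is a single cycle of length $b$ is exactly $1/b$ (independent of $n$).
   Context: There are $b$ balls on levels $1,\dots,b$. For $1\le i\le b$ the card $C_i$ induces the permutation $\pi_{C_i}$ of $[b]$ with $\pi_{C_i}(1)=i$, $\pi_{C_i}(j)=j-1$ for $2\le j\le i$, $\pi_{C_i}(j)=j$ for $j>i$. For $A=C_{i_1}\cdots C_{i_n}$, $\pi_A=\pi_{C_{i_n}}\circ\cdots\circ\pi_{C_{i_1}}$ (the ball starting at level $j$ ends at level $\pi_A(j)$). -}

module Defs where

open import Data.Nat using (ℕ; zero; suc; _≤?_)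
open import Data.Fin using (Fin; zero; suc; toℕ; inject₁)
open import Data.Vec using (Vec; []; _∷_)
open import Data.Product using (∃)
open import Function using (id; _∘_)
open import Relation.Nullary using (yes; no)
open import Relation.Binary.PropositionalEquality using (_≡_)

-- Levels 1..b are represented by Fin b, level k ↦ the element with toℕ = k - 1.
-- card i is π_{C_{i+1}} in 0-indexed form:
--   card i 0 = i ;  card i j = j - 1 for 1 ≤ j ≤ i ;  card i j = j for j > i.
card : {b : ℕ} → Fin b → Fin b → Fin b
card i zero = i
card {suc m} i (suc j) with toℕ (suc j) ≤? toℕ i
... | yes _ = inject₁ j
... | no  _ = suc j

permOf : {b n : ℕ} → Vec (Fin b) n → Fin b → Fin b
permOf []       = id
permOf (i ∷ is) = permOf is ∘ card i

iter : {A : Set} → (A → A) → ℕ → A → A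
iter f zero    x = x
iter f (suc k) x = f (iter f k x)

-- A permutation of [b] is a single cycle of length b iff every point
-- reaches every other point by iterating it.
IsFullCycle : {b : ℕ} → (Fin b → Fin b) → Set
IsFullCycle {b} π = (x y : Fin b) → ∃ λ k → iter π k x ≡ y

module Submission where

-- Card C_i moves the entry at position i of the current arrangement to
-- the front.  Recording the moved point instead of its position ("labels") is a
-- bijection of sequences, and the final arrangement is `complete d`: the distinct
-- labels d (in order of first occurrence) followed by the untouched points in
-- increasing order.  So A is a full cycle iff d is good: `complete d`, read as a
-- permutation, is a full cycle.  Removing the point 0 from that cycle (SkipZero)
-- gives a good list over one point fewer, which yields a bijection toGood between
-- duplicate-free lists over Fin b and good lists over Fin (b+1) one entry longer.
-- Hence distinct-label lists starting with 0 correspond, length for length, to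
-- good lists; renaming the labels along this correspondence maps the b^(n-1)
-- label sequences starting with 0 bijectively onto those of full cycles.

open import Defs
open import Data.Nat as ℕ using (ℕ; zero; suc; _+_; _*_; _^_; _≤_; _<_; z≤n; s≤s; _≤?_)
open import Data.Nat.Properties using (+-suc; *-comm; <-trans; <-≤-trans; ≮⇒≥)
open import Data.Fin using (Fin; zero; suc; toℕ; fromℕ<; inject₁)
open import Data.Fin.Properties using (_≟_; suc-injective; toℕ-injective; toℕ-fromℕ<; toℕ<n; toℕ-inject₁; any?)
open import Data.List using (List; []; _∷_; _++_; [_]; map; length; filterᵇ; allFin; cartesianProductWith)
open import Data.List.Properties using (length-map; length-++; length-tabulate; map-++; ++-assoc; ++-identityʳ; ∷-injectiveˡ)
open import Data.List.Relation.Unary.Unique.Propositional using (Unique)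
open import Data.List.Relation.Unary.Unique.Propositional.Properties using (map⁺; cartesianProductWith⁺; allFin⁺)
import Data.List.Relation.Unary.All as All
open import Data.List.Relation.Unary.AllPairs using ([]; _∷_)
open import Data.List.Relation.Unary.Any using (here)
open import Data.List.Membership.Propositional using (_∈_)
open import Data.List.Membership.Propositional.Properties using (∈-map⁺; ∈-map⁻; ∈-cartesianProductWith⁺; ∈-allFin)
open import Data.Vec using (Vec; []; _∷_)
import Data.Vec as Vec
open import Data.Vec.Properties using (∷-injective; map-∘; map-cong; map-id)
open import Data.Maybe using (Maybe; just; nothing; maybe′) renaming (map to mapMaybe)
open import Data.Bool using (Bool; true; false; _∨_; _∧_; not; if_then_else_)
open import Data.Bool.Properties using (∨-zeroʳ; ∨-identityʳ; ∨-assoc; ∨-comm; ∨-conicalˡ; ∨-conicalʳ; ∧-zeroʳ)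
open import Data.Product using (Σ; ∃; _×_; _,_; proj₁; proj₂)
open import Data.Sum using (_⊎_; inj₁; inj₂)
open import Data.Empty using (⊥; ⊥-elim)
open import Function using (_∘_; _∘′_; id)
open import Function.Bundles using (_⇔_; mk⇔)
open import Relation.Nullary using (does; yes; no; ¬_)
open import Relation.Binary.PropositionalEquality hiding ([_])


iter-suc : {A : Set} (f : A → A) (k : ℕ) (x : A) → iter f (suc k) x ≡ iter f k (f x)
iter-suc f zero    x = refl
iter-suc f (suc k) x = cong f (iter-suc f k x)

iter-cong : {A : Set} {f g : A → A} → (∀ x → f x ≡ g x) → ∀ k x → iter f k x ≡ iter g k x
iter-cong f≗g zero    x = refl
iter-cong {g = g} f≗g (suc k) x = trans (f≗g _) (cong g (iter-cong f≗g k x))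

full-cong : {b : ℕ} {f g : Fin b → Fin b} → (∀ x → f x ≡ g x) → IsFullCycle f → IsFullCycle g
full-cong f≗g full x y with full x y
... | k , fᵏx≡y = k , trans (sym (iter-cong f≗g k x)) fᵏx≡y

fixed-point-not-full : {n : ℕ} (τ : Fin (suc (suc n)) → Fin (suc (suc n))) →
  τ zero ≡ zero → IsFullCycle τ → ⊥
fixed-point-not-full τ τ0≡0 full with full zero (suc zero)
... | k , τᵏ0≡1 with trans (sym (stays k)) τᵏ0≡1
  where
  stays : ∀ k → iter τ k zero ≡ zero
  stays zero    = refl
  stays (suc k) = trans (cong τ (stays k)) τ0≡0
... | ()

collapse : {n : ℕ} → Fin n → Fin (suc n) → Fin n
collapse u zero    = u
collapse u (suc w) = w

-- Removing the point 0 from the cycles of τ (its preimage is sent to u = τ 0 - 1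
-- directly) keeps τ a full cycle, and conversely when τ is onto.
module SkipZero {n : ℕ} (τ : Fin (suc (suc n)) → Fin (suc (suc n))) (u : Fin (suc n))
                (τ0≡u : τ zero ≡ suc u) where

  skip : Fin (suc n) → Fin (suc n)
  skip v = collapse u (τ (suc v))

  iter-two : (k : ℕ) (x : Fin (suc (suc n))) → iter τ (suc (suc k)) x ≡ iter τ k (τ (τ x))
  iter-two k x = trans (iter-suc τ (suc k) x) (iter-suc τ k (τ x))

  shorten : (k : ℕ) (x y : Fin (suc n)) → iter τ k (suc x) ≡ suc y → ∃ λ k' → iter skip k' x ≡ y
  shorten zero    x y path = 0 , suc-injective path
  shorten (suc k) x y path = via (τ (suc x)) refl k path
    where
    via : (w : Fin (suc (suc n))) → τ (suc x) ≡ w →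
          (k : ℕ) → iter τ (suc k) (suc x) ≡ suc y → ∃ λ k' → iter skip k' x ≡ y
    via (suc w) τx≡w k path with shorten k w y (trans (sym (trans (iter-suc τ k (suc x)) (cong (iter τ k) τx≡w))) path)
    ... | k' , p = suc k' , trans (iter-suc skip k' x) (trans (cong (iter skip k' ∘′ collapse u) τx≡w) p)
    via zero τx≡0 zero path with trans (sym τx≡0) path
    ... | ()
    via zero τx≡0 (suc k) path
      with shorten k u y (trans (sym (trans (iter-two k (suc x)) (cong (iter τ k) (trans (cong τ τx≡0) τ0≡u)))) path)
    ... | k' , p = suc k' , trans (iter-suc skip k' x) (trans (cong (iter skip k' ∘′ collapse u) τx≡0) p)

  -- Conversely a skip-path lifts to a τ-path (passing through 0 where skip jumps to u).
  lengthen : (k : ℕ) (x y : Fin (suc n)) → iter skip k x ≡ y → ∃ λ j → iter τ j (suc x) ≡ suc y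
  lengthen zero    x y path = 0 , cong suc path
  lengthen (suc k) x y path = via (τ (suc x)) refl
    where
    path' : iter skip k (skip x) ≡ y
    path' = trans (sym (iter-suc skip k x)) path
    via : (w : Fin (suc (suc n))) → τ (suc x) ≡ w → ∃ λ j → iter τ j (suc x) ≡ suc y
    via (suc w) τx≡w with lengthen k w y (trans (cong (iter skip k ∘′ collapse u) (sym τx≡w)) path')
    ... | j , p = suc j , trans (iter-suc τ j (suc x)) (trans (cong (iter τ j) τx≡w) p)
    via zero τx≡0 with lengthen k u y (trans (cong (iter skip k ∘′ collapse u) (sym τx≡0)) path')
    ... | j , p = suc (suc j) , trans (iter-two j (suc x)) (trans (cong (iter τ j) (trans (cong τ τx≡0) τ0≡u)) p)

  skip-full : IsFullCycle τ → IsFullCycle skip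
  skip-full full x y with full (suc x) (suc y)
  ... | k , path = shorten k x y path

  unskip-full : (∀ y → ∃ λ x → τ x ≡ y) → IsFullCycle skip → IsFullCycle τ
  unskip-full onto full zero zero = 0 , refl
  unskip-full onto full zero (suc y) with full u y
  ... | k , p with lengthen k u y p
  ...   | j , q = suc j , trans (iter-suc τ j zero) (trans (cong (iter τ j) τ0≡u) q)
  unskip-full onto full (suc x) (suc y) with full x y
  ... | k , p = lengthen k x y p
  unskip-full onto full (suc x) zero with onto zero
  ... | zero , τ0≡0 with trans (sym τ0≡u) τ0≡0
  ...   | ()
  unskip-full onto full (suc x) zero | suc w , τw≡0 with full x w
  ... | k , p with lengthen k x w p
  ...   | j , q = suc j , trans (cong τ q) τw≡0

true≢false : true ≡ false → ⊥
true≢false ()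

_==_ : {n : ℕ} → Fin n → Fin n → Bool
a == b = does (a ≟ b)

==-refl : {n : ℕ} (a : Fin n) → (a == a) ≡ true
==-refl a with a ≟ a
... | yes _  = refl
... | no a≢a = ⊥-elim (a≢a refl)

==-suc : {n : ℕ} (a b : Fin n) → (suc a == suc b) ≡ (a == b)
==-suc a b with a ≟ b
... | yes refl = refl
... | no _     = refl

==-≢ : {n : ℕ} {a b : Fin n} → ¬ (a ≡ b) → (a == b) ≡ false
==-≢ {a = a} {b} a≢b with a ≟ b
... | yes a≡b = ⊥-elim (a≢b a≡b)
... | no _    = refl

elem : {n : ℕ} → Fin n → List (Fin n) → Bool
elem v []       = false
elem v (x ∷ xs) = (v == x) ∨ elem v xs

data Nodup {n : ℕ} : List (Fin n) → Set where
  []  : Nodup []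
  _∷_ : ∀ {x xs} → elem x xs ≡ false → Nodup xs → Nodup (x ∷ xs)

fins : (b : ℕ) → List (Fin b)
fins zero    = []
fins (suc b) = zero ∷ map suc (fins b)

-- The points not in d, in increasing order; and the arrangement "d first, then
-- the missing points in increasing order".  Every permutation produced by cards
-- will be of the form `complete d`.
missing : {b : ℕ} → List (Fin b) → List (Fin b)
missing {b} d = filterᵇ (λ v → not (elem v d)) (fins b)

complete : {b : ℕ} → List (Fin b) → List (Fin b)
complete d = d ++ missing d

remove : {n : ℕ} → Fin n → List (Fin n) → List (Fin n)
remove y []       = []
remove y (x ∷ xs) = if y == x then xs else x ∷ remove y xs

elem-++ : {n : ℕ} (v : Fin n) (a b : List (Fin n)) → elem v (a ++ b) ≡ elem v a ∨ elem v b
elem-++ v []      b = refl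
elem-++ v (x ∷ a) b rewrite elem-++ v a b with v == x
... | true  = refl
... | false = refl

elem-map-suc : {n : ℕ} (v : Fin n) (l : List (Fin n)) → elem (suc v) (map suc l) ≡ elem v l
elem-map-suc v []      = refl
elem-map-suc v (x ∷ l) rewrite ==-suc v x | elem-map-suc v l = refl

elem-zero-map-suc : {n : ℕ} (l : List (Fin n)) → elem zero (map suc l) ≡ false
elem-zero-map-suc []      = refl
elem-zero-map-suc (x ∷ l) = elem-zero-map-suc l

elem-fins : {b : ℕ} (v : Fin b) → elem v (fins b) ≡ true
elem-fins zero            = refl
elem-fins {suc b} (suc v) = trans (elem-map-suc v (fins b)) (elem-fins v)

elem-filter : {n : ℕ} (p : Fin n → Bool) (v : Fin n) (l : List (Fin n)) →
  elem v (filterᵇ p l) ≡ p v ∧ elem v l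
elem-filter p v [] = sym (∧-zeroʳ (p v))
elem-filter p v (x ∷ l) with v ≟ x
... | yes refl with p v in pv
...   | true  rewrite ==-refl v = refl
...   | false = trans (elem-filter p v l) (cong (_∧ elem v l) pv)
elem-filter p v (x ∷ l) | no v≢x with p x
...   | true  = trans (cong (_∨ elem v (filterᵇ p l)) (==-≢ v≢x)) (elem-filter p v l)
...   | false = elem-filter p v l

elem-missing : {b : ℕ} (d : List (Fin b)) (v : Fin b) → elem v (missing d) ≡ not (elem v d)
elem-missing {b} d v rewrite elem-filter (λ v → not (elem v d)) v (fins b) | elem-fins v
  with elem v d
... | true  = refl
... | false = refl

elem-complete : {b : ℕ} (d : List (Fin b)) (v : Fin b) → elem v (complete d) ≡ true
elem-complete d v rewrite elem-++ v d (missing d) | elem-missing d v with elem v d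
... | true  = refl
... | false = refl

nodup-map-suc : {n : ℕ} {l : List (Fin n)} → Nodup l → Nodup (map suc l)
nodup-map-suc []                   = []
nodup-map-suc {l = x ∷ xs} (x∉ ∷ nd) = trans (elem-map-suc x xs) x∉ ∷ nodup-map-suc nd

nodup-fins : (b : ℕ) → Nodup (fins b)
nodup-fins zero    = []
nodup-fins (suc b) = elem-zero-map-suc (fins b) ∷ nodup-map-suc (nodup-fins b)

nodup-filter : {n : ℕ} (p : Fin n → Bool) {l : List (Fin n)} → Nodup l → Nodup (filterᵇ p l)
nodup-filter p [] = []
nodup-filter p {x ∷ xs} (x∉ ∷ nd) with p x
... | true  = trans (elem-filter p x xs) (trans (cong (p x ∧_) x∉) (∧-zeroʳ (p x))) ∷ nodup-filter p nd
... | false = nodup-filter p nd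

nodup-++ : {n : ℕ} {a b : List (Fin n)} → Nodup a → Nodup b →
  (∀ v → elem v a ≡ true → elem v b ≡ false) → Nodup (a ++ b)
nodup-++ [] nb disjoint = nb
nodup-++ {a = x ∷ xs} {b} (x∉ ∷ na) nb disjoint =
  trans (elem-++ x xs b) (trans (cong (_∨ elem x b) x∉) (disjoint x (cong (_∨ elem x xs) (==-refl x))))
  ∷ nodup-++ na nb (λ v v∈ → disjoint v (trans (cong ((v == x) ∨_) v∈) (∨-zeroʳ (v == x))))

nodup-complete : {b : ℕ} {d : List (Fin b)} → Nodup d → Nodup (complete d)
nodup-complete {b} {d} nd = nodup-++ nd (nodup-filter _ (nodup-fins b))
  (λ v v∈d → trans (elem-missing d v) (cong not v∈d))

head-fresh : {n : ℕ} {x : Fin n} {xs : List (Fin n)} → Nodup (x ∷ xs) → elem x xs ≡ false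
head-fresh (x∉ ∷ _) = x∉

nodup-tail : {n : ℕ} {x : Fin n} {xs : List (Fin n)} → Nodup (x ∷ xs) → Nodup xs
nodup-tail (_ ∷ nd) = nd

elem-remove : {n : ℕ} (v y : Fin n) (l : List (Fin n)) → Nodup l →
  elem v (remove y l) ≡ not (v == y) ∧ elem v l
elem-remove v y [] nd with v == y
... | true  = refl
... | false = refl
elem-remove v y (x ∷ xs) (x∉ ∷ nd) with y ≟ x
elem-remove v y (x ∷ xs) (x∉ ∷ nd) | yes refl with v ≟ y
... | yes refl = x∉
... | no _     = refl
elem-remove v y (x ∷ xs) (x∉ ∷ nd) | no y≢x with v ≟ x
... | yes refl rewrite ==-≢ (λ v≡y → y≢x (sym v≡y)) = refl
... | no v≢x   = elem-remove v y xs nd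

nodup-remove : {n : ℕ} (y : Fin n) {l : List (Fin n)} → Nodup l → Nodup (remove y l)
nodup-remove y [] = []
nodup-remove y {x ∷ xs} (x∉ ∷ nd) with y ≟ x
... | yes _ = nd
... | no _  = trans (elem-remove x y xs nd) (trans (cong (not (x == y) ∧_) x∉) (∧-zeroʳ _))
              ∷ nodup-remove y nd

remove-absent : {n : ℕ} (y : Fin n) (l : List (Fin n)) → elem y l ≡ false → remove y l ≡ l
remove-absent y [] y∉ = refl
remove-absent y (x ∷ xs) y∉ with y ≟ x
... | yes refl = ⊥-elim (true≢false y∉)
... | no _     = cong (x ∷_) (remove-absent y xs y∉)

remove-++ˡ : {n : ℕ} (y : Fin n) (a b : List (Fin n)) → elem y a ≡ true →
  remove y (a ++ b) ≡ remove y a ++ b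
remove-++ˡ y []      b ()
remove-++ˡ y (x ∷ a) b y∈ with y ≟ x
... | yes _ = refl
... | no _  = cong (x ∷_) (remove-++ˡ y a b y∈)

remove-++ʳ : {n : ℕ} (y : Fin n) (a b : List (Fin n)) → elem y a ≡ false →
  remove y (a ++ b) ≡ a ++ remove y b
remove-++ʳ y []      b y∉ = refl
remove-++ʳ y (x ∷ a) b y∉ with y ≟ x
... | yes refl = ⊥-elim (true≢false y∉)
... | no _     = cong (x ∷_) (remove-++ʳ y a b y∉)

length-remove : {n : ℕ} (y : Fin n) (l : List (Fin n)) → elem y l ≡ true →
  suc (length (remove y l)) ≡ length l
length-remove y []       ()
length-remove y (x ∷ xs) y∈ with y ≟ x
... | yes _ = refl
... | no _  = cong suc (length-remove y xs y∈)

filter-cong : {n : ℕ} (p q : Fin n → Bool) (l : List (Fin n)) →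
  (∀ v → elem v l ≡ true → p v ≡ q v) → filterᵇ p l ≡ filterᵇ q l
filter-cong p q []      p≗q = refl
filter-cong p q (x ∷ l) p≗q rewrite p≗q x (cong (_∨ elem x l) (==-refl x)) with q x
... | true  = cong (x ∷_) (filter-cong p q l (λ v v∈ → p≗q v (trans (cong ((v == x) ∨_) v∈) (∨-zeroʳ _))))
... | false = filter-cong p q l (λ v v∈ → p≗q v (trans (cong ((v == x) ∨_) v∈) (∨-zeroʳ _)))

missing-∷ : {b : ℕ} (y : Fin b) (d : List (Fin b)) → elem y d ≡ false →
  missing (y ∷ d) ≡ remove y (missing d)
missing-∷ {b} y d y∉d = go (fins b) (nodup-fins b)
  where
  go : (l : List (Fin b)) → Nodup l →
       filterᵇ (λ v → not ((v == y) ∨ elem v d)) l ≡ remove y (filterᵇ (λ v → not (elem v d)) l)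
  go [] nd = refl
  go (x ∷ l) (x∉ ∷ nd) with x ≟ y
  ... | yes refl rewrite y∉d | ==-refl x =
    filter-cong _ _ l (λ v v∈l → cong (λ z → not (z ∨ elem v d))
      (==-≢ (λ v≡x → true≢false (trans (sym v∈l) (trans (cong (λ z → elem z l) v≡x) x∉)))))
  ... | no x≢y with elem x d
  ...   | true  = go l nd
  ...   | false rewrite ==-≢ (λ y≡x → x≢y (sym y≡x)) = cong (x ∷_) (go l nd)

length-fins : (b : ℕ) → length (fins b) ≡ b
length-fins zero    = refl
length-fins (suc b) = cong suc (trans (length-map suc (fins b)) (length-fins b))

filter-true : {n : ℕ} (l : List (Fin n)) → filterᵇ (λ _ → true) l ≡ l
filter-true []      = refl
filter-true (x ∷ l) = cong (x ∷_) (filter-true l)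

length-complete : {b : ℕ} {d : List (Fin b)} → Nodup d → length (complete d) ≡ b
length-complete {b} {[]} nd = trans (cong length (filter-true (fins b))) (length-fins b)
length-complete {b} {y ∷ d} (y∉d ∷ nd) = begin
  suc (length (d ++ missing (y ∷ d)))          ≡⟨ cong suc (length-++ d) ⟩
  suc (length d + length (missing (y ∷ d)))    ≡⟨ cong (λ z → suc (length d + length z)) (missing-∷ y d y∉d) ⟩
  suc (length d + length (remove y (missing d))) ≡⟨ sym (+-suc (length d) _) ⟩
  length d + suc (length (remove y (missing d)))
    ≡⟨ cong (length d +_) (length-remove y (missing d) (trans (elem-missing d y) (cong not y∉d))) ⟩
  length d + length (missing d)                ≡⟨ sym (length-++ d) ⟩
  length (complete d)                          ≡⟨ length-complete nd ⟩
  b                                            ∎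
  where open ≡-Reasoning

complete-to-front : {b : ℕ} (y : Fin b) (d : List (Fin b)) → Nodup d →
  complete (y ∷ remove y d) ≡ y ∷ remove y (complete d)
complete-to-front {b} y d nd with elem y d in y∈d
... | true = cong (y ∷_) (trans (cong (remove y d ++_) same-missing) (sym (remove-++ˡ y d (missing d) y∈d)))
  where
  same-missing : missing (y ∷ remove y d) ≡ missing d
  same-missing = filter-cong _ _ (fins b) (λ v _ → cong not (elem-∷-remove v))
    where
    elem-∷-remove : ∀ v → (v == y) ∨ elem v (remove y d) ≡ elem v d
    elem-∷-remove v rewrite elem-remove v y d nd with v ≟ y
    ... | yes refl = sym y∈d
    ... | no _     = refl
... | false rewrite remove-absent y d y∈d =
  cong (y ∷_) (trans (cong (d ++_) (missing-∷ y d y∈d)) (sym (remove-++ʳ y d (missing d) y∈d)))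

nthOr : {A : Set} → List A → ℕ → A → A
nthOr []       i       a = a
nthOr (x ∷ xs) zero    a = x
nthOr (x ∷ xs) (suc i) a = nthOr xs i a

nthOr-map : {A B : Set} (f : A → B) (xs : List A) (i : ℕ) (z : A) →
  nthOr (map f xs) i (f z) ≡ f (nthOr xs i z)
nthOr-map f []       i       z = refl
nthOr-map f (x ∷ xs) zero    z = refl
nthOr-map f (x ∷ xs) (suc i) z = nthOr-map f xs i z

nthOr-default : {A : Set} (l : List A) (i : ℕ) (a c : A) → i < length l → nthOr l i a ≡ nthOr l i c
nthOr-default (x ∷ l) zero    a c _         = refl
nthOr-default (x ∷ l) (suc i) a c (s≤s i<l) = nthOr-default l i a c i<l

nthOr-++ˡ : {A : Set} (a b : List A) (i : ℕ) (z : A) → i < length a → nthOr (a ++ b) i z ≡ nthOr a i z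
nthOr-++ˡ (x ∷ a) b zero    z _         = refl
nthOr-++ˡ (x ∷ a) b (suc i) z (s≤s i<a) = nthOr-++ˡ a b i z i<a

nthOr-elem : {n : ℕ} (l : List (Fin n)) (i : ℕ) (a : Fin n) → i < length l → elem (nthOr l i a) l ≡ true
nthOr-elem (x ∷ l) zero    a _         = cong (_∨ elem x l) (==-refl x)
nthOr-elem (x ∷ l) (suc i) a (s≤s i<l) =
  trans (cong ((nthOr l i a == x) ∨_) (nthOr-elem l i a i<l)) (∨-zeroʳ _)

nthOr-injective : {n : ℕ} (l : List (Fin n)) → Nodup l → (i j : ℕ) (a c : Fin n) →
  i < length l → j < length l → nthOr l i a ≡ nthOr l j c → i ≡ j
nthOr-injective (x ∷ l) nd zero zero a c _ _ _ = refl
nthOr-injective (x ∷ l) (x∉ ∷ nd) zero (suc j) a c _ (s≤s j<l) x≡ =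
  ⊥-elim (true≢false (trans (sym (nthOr-elem l j c j<l)) (trans (cong (λ z → elem z l) (sym x≡)) x∉)))
nthOr-injective (x ∷ l) (x∉ ∷ nd) (suc i) zero a c (s≤s i<l) _ ≡x =
  ⊥-elim (true≢false (trans (sym (nthOr-elem l i a i<l)) (trans (cong (λ z → elem z l) ≡x) x∉)))
nthOr-injective (x ∷ l) (_ ∷ nd) (suc i) (suc j) a c (s≤s i<l) (s≤s j<l) eq =
  cong suc (nthOr-injective l nd i j a c i<l j<l eq)

nthOr-surjective : {n : ℕ} (l : List (Fin n)) (v : Fin n) → elem v l ≡ true →
  Σ ℕ λ i → (i < length l) × (∀ a → nthOr l i a ≡ v)
nthOr-surjective []      v ()
nthOr-surjective (x ∷ l) v v∈ with v ≟ x
... | yes refl = 0 , s≤s z≤n , (λ _ → refl)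
... | no _ with nthOr-surjective l v v∈
...   | i , i<l , at-i = suc i , s≤s i<l , at-i

nthOr-remove-< : {n : ℕ} (P : List (Fin n)) → Nodup P → (i : ℕ) (w : Fin n) → i < length P →
  (j : ℕ) (z : Fin n) → j < i → nthOr (remove (nthOr P i w) P) j z ≡ nthOr P j z
nthOr-remove-< (x ∷ xs) (x∉ ∷ nd) (suc i) w (s≤s i<P) j z j<i with nthOr xs i w ≟ x
... | yes eq = ⊥-elim (true≢false (trans (sym (nthOr-elem xs i w i<P)) (trans (cong (λ q → elem q xs) eq) x∉)))
nthOr-remove-< (x ∷ xs) (x∉ ∷ nd) (suc i) w (s≤s i<P) zero    z j<i       | no _ = refl
nthOr-remove-< (x ∷ xs) (x∉ ∷ nd) (suc i) w (s≤s i<P) (suc j) z (s≤s j<i) | no _ =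
  nthOr-remove-< xs nd i w i<P j z j<i

nthOr-remove-≥ : {n : ℕ} (P : List (Fin n)) → Nodup P → (i : ℕ) (w : Fin n) → i < length P →
  (j : ℕ) (z : Fin n) → i ≤ j → nthOr (remove (nthOr P i w) P) j z ≡ nthOr P (suc j) z
nthOr-remove-≥ (x ∷ xs) (x∉ ∷ nd) zero w _ j z _ rewrite ==-refl x = refl
nthOr-remove-≥ (x ∷ xs) (x∉ ∷ nd) (suc i) w (s≤s i<P) j z i≤j with nthOr xs i w ≟ x
... | yes eq = ⊥-elim (true≢false (trans (sym (nthOr-elem xs i w i<P)) (trans (cong (λ q → elem q xs) eq) x∉)))
nthOr-remove-≥ (x ∷ xs) (x∉ ∷ nd) (suc i) w (s≤s i<P) (suc j) z (s≤s i≤j) | no _ =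
  nthOr-remove-≥ xs nd i w i<P j z i≤j

at : {b : ℕ} → List (Fin b) → Fin b → Fin b
at P p = nthOr P (toℕ p) p

record Arrangement {b : ℕ} (P : List (Fin b)) : Set where
  field
    nodup  : Nodup P
    length≡ : length P ≡ b
    all∈   : ∀ v → elem v P ≡ true

  private
    index< : (r : Fin b) → toℕ r < length P
    index< r = subst (toℕ r <_) (sym length≡) (toℕ<n r)

  at-injective : ∀ p q → at P p ≡ at P q → p ≡ q
  at-injective p q eq = toℕ-injective (nthOr-injective P nodup (toℕ p) (toℕ q) p q (index< p) (index< q) eq)

  at-surjective : ∀ v → ∃ λ p → at P p ≡ v
  at-surjective v with nthOr-surjective P v (all∈ v)
  ... | i , i<P , at-i = fromℕ< i<b , trans (cong (λ k → nthOr P k (fromℕ< i<b)) (toℕ-fromℕ< i<b)) (at-i _)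
    where i<b : i < b
          i<b = subst (i <_) length≡ i<P

arrangement-complete : {b : ℕ} {d : List (Fin b)} → Nodup d → Arrangement (complete d)
arrangement-complete {d = d} nd = record
  { nodup = nodup-complete nd ; length≡ = length-complete nd ; all∈ = elem-complete d }

to-front-card : {b : ℕ} (P : List (Fin b)) → Nodup P → length P ≡ b → (p q : Fin b) →
  at (at P p ∷ remove (at P p) P) q ≡ at P (card p q)
to-front-card P nd len p zero = refl
to-front-card {suc m} P nd len p (suc j) with toℕ (suc j) ≤? toℕ p
... | yes j<p = begin
  nthOr (remove (at P p) P) (toℕ j) (suc j)  ≡⟨ nthOr-remove-< P nd (toℕ p) p (index< p) (toℕ j) (suc j) j<p ⟩
  nthOr P (toℕ j) (suc j)                    ≡⟨ nthOr-default P (toℕ j) (suc j) (inject₁ j) (<-trans j<p (index< p)) ⟩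
  nthOr P (toℕ j) (inject₁ j)                ≡⟨ cong (λ k → nthOr P k (inject₁ j)) (sym (toℕ-inject₁ j)) ⟩
  at P (inject₁ j)                           ∎
  where
  open ≡-Reasoning
  index< : (r : Fin (suc m)) → toℕ r < length P
  index< r = subst (toℕ r <_) (sym len) (toℕ<n r)
... | no j≮p = nthOr-remove-≥ P nd (toℕ p) p (subst (toℕ p <_) (sym len) (toℕ<n p)) (toℕ j) (suc j) (≮⇒≥ j≮p)

abstract
  position : {b : ℕ} → List (Fin b) → Fin b → Fin b
  position P v with any? (λ p → at P p ≟ v)
  ... | yes (p , _) = p
  ... | no _        = v

  at-position : {b : ℕ} {P : List (Fin b)} → Arrangement P → ∀ v → at P (position P v) ≡ v
  at-position {P = P} arr v with any? (λ p → at P p ≟ v)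
  ... | yes (p , at-p) = at-p
  ... | no none        = ⊥-elim (none (Arrangement.at-surjective arr v))

  position-at : {b : ℕ} {P : List (Fin b)} → Arrangement P → ∀ p → position P (at P p) ≡ p
  position-at {P = P} arr p with any? (λ q → at P q ≟ at P p)
  ... | yes (q , at-q) = Arrangement.at-injective arr q p at-q
  ... | no none        = ⊥-elim (none (p , refl))

distinct : {b n : ℕ} → Vec (Fin b) n → List (Fin b)
distinct []       = []
distinct (y ∷ xs) = y ∷ remove y (distinct xs)

nodup-distinct : {b n : ℕ} (xs : Vec (Fin b) n) → Nodup (distinct xs)
nodup-distinct []       = []
nodup-distinct (y ∷ xs) =
  trans (elem-remove y y (distinct xs) (nodup-distinct xs)) (cong (λ z → not z ∧ elem y (distinct xs)) (==-refl y))
  ∷ nodup-remove y (nodup-distinct xs)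

nonempty-distinct : {b n : ℕ} (xs : Vec (Fin b) (suc n)) → 0 < length (distinct xs)
nonempty-distinct (_ ∷ _) = s≤s z≤n

head-distinct : {b n : ℕ} (x : Vec (Fin b) (suc n)) {v : Fin b} {t : List (Fin b)} →
  distinct x ≡ v ∷ t → x ≡ v ∷ Vec.tail x
head-distinct (h ∷ w) eq = cong (_∷ w) (∷-injectiveˡ eq)

-- The arrangement obtained from the identity by moving the labels to the front,
-- the last label first: the distinct labels, then the untouched points in order.
arrangementOf : {b n : ℕ} → Vec (Fin b) n → List (Fin b)
arrangementOf xs = complete (distinct xs)

arrangement-arrangementOf : {b n : ℕ} (xs : Vec (Fin b) n) → Arrangement (arrangementOf xs)
arrangement-arrangementOf xs = arrangement-complete (nodup-distinct xs)

-- Labels of a card sequence: card p moves the point at position p of the current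
-- arrangement to the front; we record that point instead of p.  `levels` undoes this.
labels : {b n : ℕ} → Vec (Fin b) n → Vec (Fin b) n
labels []       = []
labels (p ∷ ps) = at (arrangementOf (labels ps)) p ∷ labels ps

levels : {b n : ℕ} → Vec (Fin b) n → Vec (Fin b) n
levels []       = []
levels (y ∷ xs) = position (arrangementOf xs) y ∷ levels xs

labels-levels : {b n : ℕ} (xs : Vec (Fin b) n) → labels (levels xs) ≡ xs
labels-levels []       = refl
labels-levels (y ∷ xs) rewrite labels-levels xs =
  cong (_∷ xs) (at-position (arrangement-arrangementOf xs) y)

levels-labels : {b n : ℕ} (ps : Vec (Fin b) n) → levels (labels ps) ≡ ps
levels-labels []       = refl
levels-labels (p ∷ ps) rewrite levels-labels ps =
  cong (_∷ ps) (position-at (arrangement-arrangementOf (labels ps)) p)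

at-fins : (b : ℕ) (q : Fin b) → at (fins b) q ≡ q
at-fins (suc b) zero    = refl
at-fins (suc b) (suc q) = trans (nthOr-map suc (fins b) (toℕ q) q) (cong suc (at-fins b q))

permOf-arrangement : {b n : ℕ} (A : Vec (Fin b) n) (q : Fin b) →
  permOf A q ≡ at (arrangementOf (labels A)) q
permOf-arrangement {b} [] q = sym (trans (cong (λ L → at L q) (filter-true (fins b))) (at-fins b q))
permOf-arrangement {b} {suc n} (p ∷ ps) q = begin
  permOf ps (card p q)
    ≡⟨ permOf-arrangement ps (card p q) ⟩
  at P (card p q)
    ≡⟨ sym (to-front-card P (Arrangement.nodup arr) (Arrangement.length≡ arr) p q) ⟩
  at (at P p ∷ remove (at P p) P) q
    ≡⟨ cong (λ L → at L q) (sym (complete-to-front (at P p) (distinct xs) (nodup-distinct xs))) ⟩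
  at (arrangementOf (labels (p ∷ ps))) q
    ∎
  where
  open ≡-Reasoning
  xs : Vec (Fin b) n
  xs = labels ps
  P : List (Fin b)
  P = arrangementOf xs
  arr : Arrangement P
  arr = arrangement-arrangementOf xs

permOf-levels : {b n : ℕ} (y : Vec (Fin b) n) (q : Fin b) → permOf (levels y) q ≡ at (complete (distinct y)) q
permOf-levels y q = trans (permOf-arrangement (levels y) q) (cong (λ z → at (arrangementOf z) q) (labels-levels y))

==-injective : {b : ℕ} (ψ : Fin b → Fin b) → (∀ x y → ψ x ≡ ψ y → x ≡ y) →
  ∀ x y → (ψ x == ψ y) ≡ (x == y)
==-injective ψ inj x y with x ≟ y
... | yes refl = ==-refl (ψ x)
... | no x≢y   = ==-≢ (λ eq → x≢y (inj x y eq))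

remove-map : {b : ℕ} (ψ : Fin b → Fin b) → (∀ x y → ψ x ≡ ψ y → x ≡ y) →
  ∀ y l → remove (ψ y) (map ψ l) ≡ map ψ (remove y l)
remove-map ψ inj y []      = refl
remove-map ψ inj y (x ∷ l) rewrite ==-injective ψ inj y x with y == x
... | true  = refl
... | false = cong (ψ x ∷_) (remove-map ψ inj y l)

distinct-map : {b n : ℕ} (ψ : Fin b → Fin b) → (∀ x y → ψ x ≡ ψ y → x ≡ y) →
  (xs : Vec (Fin b) n) → distinct (Vec.map ψ xs) ≡ map ψ (distinct xs)
distinct-map ψ inj []       = refl
distinct-map ψ inj (y ∷ xs) rewrite distinct-map ψ inj xs = cong (ψ y ∷_) (remove-map ψ inj y (distinct xs))

relabel : {b : ℕ} → List (Fin b) → List (Fin b) → Fin b → Fin b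
relabel P Q v = at Q (position P v)

relabel-inverse : {b : ℕ} {P Q : List (Fin b)} → Arrangement P → Arrangement Q →
  ∀ v → relabel Q P (relabel P Q v) ≡ v
relabel-inverse {P = P} arrP arrQ v = trans (cong (at P) (position-at arrQ _)) (at-position arrP v)

list-ext : {A : Set} (a c : List A) → length a ≡ length c →
  (∀ i (z : A) → i < length a → nthOr a i z ≡ nthOr c i z) → a ≡ c
list-ext []      []      _   _    = refl
list-ext (x ∷ a) (y ∷ c) len same =
  cong₂ _∷_ (same 0 x (s≤s z≤n)) (list-ext a c (cong ℕ.pred len) (λ i z i<a → same (suc i) z (s≤s i<a)))

length-++ˡ : {A : Set} (a c : List A) → length a ≤ length (a ++ c)
length-++ˡ []      c = z≤n
length-++ˡ (x ∷ a) c = s≤s (length-++ˡ a c)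

relabel-map : {b : ℕ} (e d : List (Fin b)) → Nodup e → Nodup d → length e ≡ length d →
  map (relabel (complete e) (complete d)) e ≡ d
relabel-map {b} e d nde ndd len = list-ext _ d (trans (length-map ψ e) len) entry
  where
  ψ : Fin b → Fin b
  ψ = relabel (complete e) (complete d)
  entry : ∀ i z → i < length (map ψ e) → nthOr (map ψ e) i z ≡ nthOr d i z
  entry i z i<ψe = begin
    nthOr (map ψ e) i z               ≡⟨ nthOr-default (map ψ e) i z (ψ p) i<ψe ⟩
    nthOr (map ψ e) i (ψ p)           ≡⟨ nthOr-map ψ e i p ⟩
    ψ (nthOr e i p)                   ≡⟨ cong ψ (sym (nthOr-++ˡ e (missing e) i p i<e)) ⟩
    ψ (nthOr (complete e) i p)        ≡⟨ cong (λ k → ψ (nthOr (complete e) k p)) (sym toℕp) ⟩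
    ψ (at (complete e) p)             ≡⟨ cong (at (complete d)) (position-at (arrangement-complete nde) p) ⟩
    at (complete d) p                 ≡⟨ cong (λ k → nthOr (complete d) k p) toℕp ⟩
    nthOr (complete d) i p            ≡⟨ nthOr-++ˡ d (missing d) i p i<d ⟩
    nthOr d i p                       ≡⟨ nthOr-default d i p z i<d ⟩
    nthOr d i z                       ∎
    where
    open ≡-Reasoning
    i<e : i < length e
    i<e = subst (i <_) (length-map ψ e) i<ψe
    i<d : i < length d
    i<d = subst (i <_) len i<e
    i<b : i < b
    i<b = <-≤-trans i<e (subst (length e ≤_) (length-complete nde) (length-++ˡ e (missing e)))
    p : Fin b
    p = fromℕ< i<b
    toℕp : toℕ p ≡ i
    toℕp = toℕ-fromℕ< i<b

relabelTo : {b n : ℕ} → List (Fin b) → Vec (Fin b) n → Vec (Fin b) n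
relabelTo d x = Vec.map (relabel (complete (distinct x)) (complete d)) x

distinct-relabelTo : {b n : ℕ} (d : List (Fin b)) (x : Vec (Fin b) n) → Nodup d → length (distinct x) ≡ length d →
  distinct (relabelTo d x) ≡ d
distinct-relabelTo {b} d x nd len = trans (distinct-map ψ ψ-injective x) (relabel-map (distinct x) d ndx nd len)
  where
  ndx : Nodup (distinct x)
  ndx = nodup-distinct x
  ψ : Fin b → Fin b
  ψ = relabel (complete (distinct x)) (complete d)
  ψ-injective : ∀ a c → ψ a ≡ ψ c → a ≡ c
  ψ-injective a c ψa≡ψc = begin
    a                                              ≡⟨ sym (relabel-inverse arr-x arr-d a) ⟩
    relabel (complete d) (complete (distinct x)) (ψ a) ≡⟨ cong (relabel (complete d) (complete (distinct x))) ψa≡ψc ⟩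
    relabel (complete d) (complete (distinct x)) (ψ c) ≡⟨ relabel-inverse arr-x arr-d c ⟩
    c                                              ∎
    where
    open ≡-Reasoning
    arr-x : Arrangement (complete (distinct x))
    arr-x = arrangement-complete ndx
    arr-d : Arrangement (complete d)
    arr-d = arrangement-complete nd

relabelTo-relabelTo : {b n : ℕ} (d : List (Fin b)) (x : Vec (Fin b) n) → Nodup d → length (distinct x) ≡ length d →
  relabelTo (distinct x) (relabelTo d x) ≡ x
relabelTo-relabelTo {b} d x nd len rewrite distinct-relabelTo d x nd len = begin
  Vec.map ψ⁻¹ (Vec.map ψ x)  ≡⟨ sym (map-∘ ψ⁻¹ ψ x) ⟩
  Vec.map (ψ⁻¹ ∘ ψ) x        ≡⟨ map-cong (relabel-inverse (arrangement-complete (nodup-distinct x))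
                                                          (arrangement-complete nd)) x ⟩
  Vec.map id x               ≡⟨ map-id x ⟩
  x                          ∎
  where
  open ≡-Reasoning
  ψ ψ⁻¹ : Fin b → Fin b
  ψ   = relabel (complete (distinct x)) (complete d)
  ψ⁻¹ = relabel (complete d) (complete (distinct x))

lower : {n : ℕ} → List (Fin (suc n)) → List (Fin n)
lower []           = []
lower (zero  ∷ xs) = lower xs
lower (suc x ∷ xs) = x ∷ lower xs

zeroAt : {n : ℕ} → List (Fin (suc n)) → Maybe ℕ
zeroAt []           = nothing
zeroAt (zero  ∷ xs) = just 0
zeroAt (suc x ∷ xs) = mapMaybe ℕ.suc (zeroAt xs)

-- Inserts a zero at index j; a duplicate-free f is recovered from `lower f`
-- and `zeroAt f`.
insertZero : {m : ℕ} → ℕ → List (Fin (suc m)) → List (Fin (suc m))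
insertZero zero    l       = zero ∷ l
insertZero (suc j) []      = zero ∷ []
insertZero (suc j) (x ∷ l) = x ∷ insertZero j l

putZero : {m : ℕ} → ℕ → List (Fin (suc m)) → List (Fin (suc m))
putZero j       []       = []
putZero zero    (x ∷ xs) = zero ∷ xs
putZero (suc j) (x ∷ xs) = x ∷ putZero j xs

lastOf : {A : Set} → A → List A → A
lastOf x []       = x
lastOf x (y ∷ ys) = lastOf y ys

initOf : {A : Set} → A → List A → List A
initOf x []       = []
initOf x (y ∷ ys) = x ∷ initOf y ys

rotate : {A : Set} → List A → List A
rotate []       = []
rotate (x ∷ xs) = lastOf x xs ∷ initOf x xs

lower-map-suc : {n : ℕ} (l : List (Fin n)) → lower (map suc l) ≡ l
lower-map-suc []      = refl
lower-map-suc (x ∷ l) = cong (x ∷_) (lower-map-suc l)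

zeroAt-map-suc : {n : ℕ} (l : List (Fin n)) → zeroAt (map suc l) ≡ nothing
zeroAt-map-suc []      = refl
zeroAt-map-suc (x ∷ l) rewrite zeroAt-map-suc l = refl

map-suc-nothing : (m : Maybe ℕ) → mapMaybe ℕ.suc m ≡ nothing → m ≡ nothing
map-suc-nothing nothing _ = refl

map-suc-just : {j : ℕ} (m : Maybe ℕ) → mapMaybe ℕ.suc m ≡ just (suc j) → m ≡ just j
map-suc-just (just x) refl = refl

map-suc-just0 : (m : Maybe ℕ) → mapMaybe ℕ.suc m ≡ just 0 → ⊥
map-suc-just0 nothing  ()
map-suc-just0 (just x) ()

zeroAt-nothing : {n : ℕ} (l : List (Fin (suc n))) → zeroAt l ≡ nothing → map suc (lower l) ≡ l
zeroAt-nothing []           _    = refl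
zeroAt-nothing (zero  ∷ l)  ()
zeroAt-nothing (suc x ∷ l)  none = cong (suc x ∷_) (zeroAt-nothing l (map-suc-nothing (zeroAt l) none))

zeroAt-nothing-elem : {n : ℕ} (l : List (Fin (suc n))) → zeroAt l ≡ nothing → elem zero l ≡ false
zeroAt-nothing-elem []          _    = refl
zeroAt-nothing-elem (zero  ∷ l) ()
zeroAt-nothing-elem (suc x ∷ l) none = zeroAt-nothing-elem l (map-suc-nothing (zeroAt l) none)

zeroAt-elem : {n : ℕ} (l : List (Fin (suc n))) → elem zero l ≡ false → zeroAt l ≡ nothing
zeroAt-elem []          _  = refl
zeroAt-elem (zero  ∷ l) ()
zeroAt-elem (suc x ∷ l) 0∉ rewrite zeroAt-elem l 0∉ = refl

zeroAt-just-elem : {n : ℕ} (l : List (Fin (suc n))) (j : ℕ) → zeroAt l ≡ just j → elem zero l ≡ true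
zeroAt-just-elem (zero  ∷ l) j       _  = refl
zeroAt-just-elem (suc x ∷ l) zero    at = ⊥-elim (map-suc-just0 (zeroAt l) at)
zeroAt-just-elem (suc x ∷ l) (suc j) at = zeroAt-just-elem l j (map-suc-just (zeroAt l) at)

zeroAt-just-< : {n : ℕ} (l : List (Fin (suc n))) (j : ℕ) → zeroAt l ≡ just j → j < length l
zeroAt-just-< (zero  ∷ l) .0      refl = s≤s z≤n
zeroAt-just-< (suc x ∷ l) zero    at   = ⊥-elim (map-suc-just0 (zeroAt l) at)
zeroAt-just-< (suc x ∷ l) (suc j) at   = s≤s (zeroAt-just-< l j (map-suc-just (zeroAt l) at))

zeroAt-just : {n : ℕ} (l : List (Fin (suc n))) (j : ℕ) → zeroAt l ≡ just j → Nodup l →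
  insertZero j (map suc (lower l)) ≡ l
zeroAt-just (zero  ∷ l) .0      refl (0∉ ∷ _)  = cong (zero ∷_) (zeroAt-nothing l (zeroAt-elem l 0∉))
zeroAt-just (suc x ∷ l) zero    at   _         = ⊥-elim (map-suc-just0 (zeroAt l) at)
zeroAt-just (suc x ∷ l) (suc j) at   (_ ∷ nd)  = cong (suc x ∷_) (zeroAt-just l j (map-suc-just (zeroAt l) at) nd)

length-insertZero : {m : ℕ} (s : List (Fin (suc m))) (j : ℕ) → length (insertZero j s) ≡ suc (length s)
length-insertZero s       zero    = refl
length-insertZero []      (suc j) = refl
length-insertZero (x ∷ s) (suc j) = cong suc (length-insertZero s j)

length-lower-nothing : {n : ℕ} (l : List (Fin (suc n))) → zeroAt l ≡ nothing → length (lower l) ≡ length l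
length-lower-nothing l none = trans (sym (length-map suc (lower l))) (cong length (zeroAt-nothing l none))

length-lower-just : {n : ℕ} (l : List (Fin (suc n))) (j : ℕ) → zeroAt l ≡ just j → Nodup l →
  suc (length (lower l)) ≡ length l
length-lower-just l j at nd = begin
  suc (length (lower l))                      ≡⟨ cong suc (sym (length-map suc (lower l))) ⟩
  suc (length (map suc (lower l)))            ≡⟨ sym (length-insertZero (map suc (lower l)) j) ⟩
  length (insertZero j (map suc (lower l)))   ≡⟨ cong length (zeroAt-just l j at nd) ⟩
  length l                                    ∎
  where open ≡-Reasoning

zeroAt-insertZero : {n : ℕ} (g : List (Fin n)) (j : ℕ) → j ≤ length g → zeroAt (insertZero j (map suc g)) ≡ just j
zeroAt-insertZero g       zero    _         = refl
zeroAt-insertZero (x ∷ g) (suc j) (s≤s j≤g) rewrite zeroAt-insertZero g j j≤g = refl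

lower-insertZero : {n : ℕ} (g : List (Fin n)) (j : ℕ) → lower (insertZero j (map suc g)) ≡ g
lower-insertZero g       zero    = lower-map-suc g
lower-insertZero []      (suc j) = refl
lower-insertZero (x ∷ g) (suc j) = cong (x ∷_) (lower-insertZero g j)

nodup-lower : {n : ℕ} {l : List (Fin (suc n))} → Nodup l → Nodup (lower l)
nodup-lower [] = []
nodup-lower {l = zero  ∷ l} (_ ∷ nd) = nodup-lower nd
nodup-lower {l = suc x ∷ l} (x∉ ∷ nd) = lowered x l x∉ ∷ nodup-lower nd
  where
  lowered : {n : ℕ} (x : Fin n) (l : List (Fin (suc n))) → elem (suc x) l ≡ false → elem x (lower l) ≡ false
  lowered x []          _  = refl
  lowered x (zero  ∷ l) x∉ = lowered x l x∉
  lowered x (suc y ∷ l) x∉ rewrite sym (==-suc x y) with suc x == suc y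
  ... | false = lowered x l x∉

Good : {b : ℕ} → List (Fin b) → Set
Good d = IsFullCycle (at (complete d))

map-collapse-suc : {n : ℕ} (u : Fin n) (l : List (Fin n)) → map (collapse u) (map suc l) ≡ l
map-collapse-suc u []      = refl
map-collapse-suc u (x ∷ l) = cong (x ∷_) (map-collapse-suc u l)

map-suc-collapse : {n : ℕ} (u : Fin n) (l : List (Fin (suc n))) → elem zero l ≡ false →
  map suc (map (collapse u) l) ≡ l
map-suc-collapse u []          _  = refl
map-suc-collapse u (zero  ∷ l) ()
map-suc-collapse u (suc x ∷ l) 0∉ = cong (suc x ∷_) (map-suc-collapse u l 0∉)

elem-map-collapse : {n : ℕ} (u v : Fin n) (l : List (Fin (suc n))) →
  elem v (map (collapse u) l) ≡ (elem zero l ∧ (v == u)) ∨ elem (suc v) l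
elem-map-collapse u v [] = refl
elem-map-collapse u v (zero ∷ l) rewrite elem-map-collapse u v l with v == u
... | true  = refl
... | false = cong (_∨ elem (suc v) l) (∧-zeroʳ (elem zero l))
elem-map-collapse u v (suc x ∷ l) rewrite elem-map-collapse u v l | ==-suc v x =
  trans (sym (∨-assoc (v == x) a c)) (trans (cong (_∨ c) (∨-comm (v == x) a)) (∨-assoc a (v == x) c))
  where
  a c : Bool
  a = elem zero l ∧ (v == u)
  c = elem (suc v) l

nodup-map-collapse : {n : ℕ} (u : Fin n) (l : List (Fin (suc n))) → Nodup l → elem (suc u) l ≡ false →
  Nodup (map (collapse u) l)
nodup-map-collapse u [] _ _ = []
nodup-map-collapse u (zero ∷ l) (0∉ ∷ nd) su∉ =
  trans (elem-map-collapse u u l) (trans (cong (λ z → z ∧ (u == u) ∨ elem (suc u) l) 0∉) su∉)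
  ∷ nodup-map-collapse u l nd su∉
nodup-map-collapse u (suc x ∷ l) (x∉ ∷ nd) su∉ with x ≟ u
... | yes refl rewrite ==-refl (suc x) = ⊥-elim (true≢false su∉)
... | no x≢u rewrite ==-≢ {a = suc u} (λ su≡sx → x≢u (sym (suc-injective su≡sx))) =
  trans (elem-map-collapse u x l)
        (trans (cong (λ z → elem zero l ∧ z ∨ elem (suc x) l) (==-≢ x≢u))
               (trans (cong (_∨ elem (suc x) l) (∧-zeroʳ (elem zero l))) x∉))
  ∷ nodup-map-collapse u l nd su∉

filter-map-suc : {n : ℕ} (p : Fin (suc n) → Bool) (l : List (Fin n)) →
  filterᵇ p (map suc l) ≡ map suc (filterᵇ (λ v → p (suc v)) l)
filter-map-suc p []      = refl
filter-map-suc p (x ∷ l) with p (suc x)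
... | true  = cong (suc x ∷_) (filter-map-suc p l)
... | false = filter-map-suc p l

zeroIfAbsent : {n : ℕ} → List (Fin (suc n)) → List (Fin (suc n))
zeroIfAbsent xs = maybe′ (λ _ → []) [ zero ] (zeroAt xs)

elem-zero-zeroIfAbsent : {n : ℕ} (xs : List (Fin (suc n))) → elem zero (xs ++ zeroIfAbsent xs) ≡ true
elem-zero-zeroIfAbsent xs with zeroAt xs in at
... | nothing = trans (elem-++ zero xs [ zero ]) (∨-zeroʳ _)
... | just j  = trans (elem-++ zero xs []) (cong (_∨ false) (zeroAt-just-elem xs j at))

elem-suc-zeroIfAbsent : {n : ℕ} (v : Fin n) (xs : List (Fin (suc n))) →
  elem (suc v) (xs ++ zeroIfAbsent xs) ≡ elem (suc v) xs
elem-suc-zeroIfAbsent v xs with zeroAt xs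
... | nothing = trans (elem-++ (suc v) xs [ zero ]) (∨-identityʳ _)
... | just j  = trans (elem-++ (suc v) xs []) (∨-identityʳ _)

-- The prefix of the contracted arrangement: 0 (appended if it is missing) is
-- replaced by u, every other point lowered by one.
contract : {n : ℕ} → Fin (suc n) → List (Fin (suc (suc n))) → List (Fin (suc n))
contract u xs = map (collapse u) (xs ++ zeroIfAbsent xs)

missing-suc-∷ : {n : ℕ} (u : Fin (suc n)) (xs : List (Fin (suc (suc n)))) →
  missing (suc u ∷ xs) ≡ zeroIfAbsent xs ++ map suc (missing (contract u xs))
missing-suc-∷ {n} u xs = trans split (cong (λ r → zeroIfAbsent xs ++ map suc r) lowered)
  where
  p : Fin (suc (suc n)) → Bool
  p v = not (elem v (suc u ∷ xs))
  split : missing (suc u ∷ xs) ≡ zeroIfAbsent xs ++ map suc (filterᵇ (λ v → p (suc v)) (fins (suc n)))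
  split with zeroAt xs in at
  ... | nothing rewrite zeroAt-nothing-elem xs at = cong (zero ∷_) (filter-map-suc p (fins (suc n)))
  ... | just j  rewrite zeroAt-just-elem xs j at  = filter-map-suc p (fins (suc n))
  lowered : filterᵇ (λ v → p (suc v)) (fins (suc n)) ≡ missing (contract u xs)
  lowered = filter-cong _ _ (fins (suc n)) (λ v _ → cong not (same v))
    where
    same : ∀ v → elem (suc v) (suc u ∷ xs) ≡ elem v (contract u xs)
    same v rewrite elem-map-collapse u v (xs ++ zeroIfAbsent xs) | elem-zero-zeroIfAbsent xs
                 | elem-suc-zeroIfAbsent v xs | ==-suc v u = refl

collapse-complete : {n : ℕ} (u : Fin (suc n)) (xs : List (Fin (suc (suc n)))) →
  map (collapse u) (xs ++ missing (suc u ∷ xs)) ≡ complete (contract u xs)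
collapse-complete {n} u xs = begin
  map (collapse u) (xs ++ missing (suc u ∷ xs))
    ≡⟨ cong (λ c → map (collapse u) (xs ++ c)) (missing-suc-∷ u xs) ⟩
  map (collapse u) (xs ++ (zeroIfAbsent xs ++ map suc M))
    ≡⟨ cong (map (collapse u)) (sym (++-assoc xs (zeroIfAbsent xs) (map suc M))) ⟩
  map (collapse u) ((xs ++ zeroIfAbsent xs) ++ map suc M)
    ≡⟨ map-++ (collapse u) (xs ++ zeroIfAbsent xs) (map suc M) ⟩
  contract u xs ++ map (collapse u) (map suc M)
    ≡⟨ cong (contract u xs ++_) (map-collapse-suc u M) ⟩
  contract u xs ++ M
    ∎
  where
  open ≡-Reasoning
  M : List (Fin (suc n))
  M = missing (contract u xs)

module GoodContract {n : ℕ} (u : Fin (suc n)) (xs : List (Fin (suc (suc n)))) where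
  open SkipZero (at (complete (suc u ∷ xs))) u refl

  skip≗ : ∀ v → skip v ≡ at (complete (contract u xs)) v
  skip≗ v = trans (sym (nthOr-map (collapse u) (xs ++ missing (suc u ∷ xs)) (toℕ v) (suc v)))
                  (cong (λ L → nthOr L (toℕ v) v) (collapse-complete u xs))

  good-contract : Good (suc u ∷ xs) → Good (contract u xs)
  good-contract good = full-cong skip≗ (skip-full good)

  contract-good : Nodup (suc u ∷ xs) → Good (contract u xs) → Good (suc u ∷ xs)
  contract-good nd good =
    unskip-full (Arrangement.at-surjective (arrangement-complete nd)) (full-cong (λ v → sym (skip≗ v)) good)

not-good-zero∷ : {n : ℕ} (xs : List (Fin (suc (suc n)))) → Good (zero ∷ xs) → ⊥
not-good-zero∷ xs = fixed-point-not-full (at (complete (zero ∷ xs))) refl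

-- Undoes a contraction whose result is g, given where 0 was in the tail: if it
-- was absent, u = last g and the tail is the rest of g; if it was at index j,
-- u is the j-th entry of g, which is replaced by 0.
uncontract : {n : ℕ} → List (Fin (suc n)) → Maybe ℕ → List (Fin (suc (suc n)))
uncontract g nothing  = rotate (map suc g)
uncontract g (just j) = nthOr (map suc g) j zero ∷ putZero j (map suc g)

insertZero? : {n : ℕ} → Maybe ℕ → List (Fin (suc n)) → List (Fin (suc n))
insertZero? nothing  l = l
insertZero? (just j) l = insertZero j l

-- The bijection between duplicate-free lists f over Fin n and good lists of
-- length 1 + length f over Fin (suc n), by recursion on n through contraction.
toGood : (n : ℕ) → List (Fin n) → List (Fin (suc n))
toGood zero    f = zero ∷ []
toGood (suc n) f = uncontract (toGood n (lower f)) (zeroAt f)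

fromGood : (n : ℕ) → List (Fin (suc n)) → List (Fin n)
fromGood zero    d            = []
fromGood (suc n) []           = []
fromGood (suc n) (zero  ∷ xs) = []
fromGood (suc n) (suc u ∷ xs) = insertZero? (zeroAt xs) (map suc (fromGood n (contract u xs)))

lastOf-++ : {A : Set} (x a : A) (l : List A) → lastOf x (l ++ [ a ]) ≡ a
lastOf-++ x a []      = refl
lastOf-++ x a (y ∷ l) = lastOf-++ y a l

initOf-++ : {A : Set} (x a : A) (l : List A) → initOf x (l ++ [ a ]) ≡ x ∷ l
initOf-++ x a []      = refl
initOf-++ x a (y ∷ l) = cong (x ∷_) (initOf-++ y a l)

rotate-++ : {A : Set} (l : List A) (a : A) → rotate (l ++ [ a ]) ≡ a ∷ l
rotate-++ []      a = refl
rotate-++ (x ∷ l) a = cong₂ _∷_ (lastOf-++ x a l) (initOf-++ x a l)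

initOf-lastOf : {A : Set} (a : A) (l : List A) → initOf a l ++ [ lastOf a l ] ≡ a ∷ l
initOf-lastOf a []      = refl
initOf-lastOf a (y ∷ l) = cong (a ∷_) (initOf-lastOf y l)

lastOf-map : {A B : Set} (f : A → B) (a : A) (l : List A) → lastOf (f a) (map f l) ≡ f (lastOf a l)
lastOf-map f a []      = refl
lastOf-map f a (y ∷ l) = lastOf-map f y l

initOf-map : {A B : Set} (f : A → B) (a : A) (l : List A) → initOf (f a) (map f l) ≡ map f (initOf a l)
initOf-map f a []      = refl
initOf-map f a (y ∷ l) = cong (f a ∷_) (initOf-map f y l)

length-rotate : {A : Set} (l : List A) → length (rotate l) ≡ length l
length-rotate []      = refl
length-rotate (x ∷ l) = cong suc (length-initOf x l)
  where
  length-initOf : (x : _) (l : List _) → length (initOf x l) ≡ length l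
  length-initOf x []      = refl
  length-initOf x (y ∷ l) = cong suc (length-initOf y l)

length-putZero : {m : ℕ} (j : ℕ) (s : List (Fin (suc m))) → length (putZero j s) ≡ length s
length-putZero j       []      = refl
length-putZero zero    (x ∷ s) = refl
length-putZero (suc j) (x ∷ s) = cong suc (length-putZero j s)

uncollapse-at : {n : ℕ} (u : Fin (suc n)) (xs : List (Fin (suc (suc n)))) (j : ℕ) → zeroAt xs ≡ just j →
  Nodup xs → (nthOr (map suc (map (collapse u) xs)) j zero ≡ suc u) × (putZero j (map suc (map (collapse u) xs)) ≡ xs)
uncollapse-at u (zero  ∷ xs) .0      refl    (0∉ ∷ _)  = refl , cong (zero ∷_) (map-suc-collapse u xs 0∉)
uncollapse-at u (suc x ∷ xs) zero    at      _         = ⊥-elim (map-suc-just0 (zeroAt xs) at)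
uncollapse-at u (suc x ∷ xs) (suc j) at      (_ ∷ nd) with uncollapse-at u xs j (map-suc-just (zeroAt xs) at) nd
... | entry , restored = entry , cong (suc x ∷_) restored

collapse-putZero : {n : ℕ} (d : List (Fin (suc n))) (j : ℕ) (u : Fin (suc n)) → j < length d → nthOr d j zero ≡ u →
  (nthOr (map suc d) j zero ≡ suc u) × (map (collapse u) (putZero j (map suc d)) ≡ d) ×
  (zeroAt (putZero j (map suc d)) ≡ just j)
collapse-putZero (x ∷ d) zero    u _         refl = refl , cong (x ∷_) (map-collapse-suc x d) , refl
collapse-putZero (x ∷ d) (suc j) u (s≤s j<d) at-j with collapse-putZero d j u j<d at-j
... | entry , restored , zero-at rewrite zero-at = entry , cong (x ∷_) restored , refl

elem-putZero : {m : ℕ} (v : Fin (suc m)) (j : ℕ) (s : List (Fin (suc m))) → elem v (putZero j s) ≡ true →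
  (v ≡ zero) ⊎ (elem v s ≡ true)
elem-putZero v j [] ()
elem-putZero v zero (x ∷ s) v∈ with v ≟ zero
... | yes v≡0 = inj₁ v≡0
... | no v≢0 = inj₂ (trans (cong ((v == x) ∨_) v∈) (∨-zeroʳ _))
elem-putZero v (suc j) (x ∷ s) v∈ with v ≟ x
... | yes refl = inj₂ refl
... | no v≢x = elem-putZero v j s v∈

nodup-take-out : {m : ℕ} (j : ℕ) (s : List (Fin (suc m))) → Nodup s → elem zero s ≡ false → j < length s →
  Nodup (nthOr s j zero ∷ putZero j s)
nodup-take-out zero (x ∷ s) (x∉ ∷ nd) 0∉ _ with x ≟ zero
... | yes refl = ⊥-elim (true≢false 0∉)
... | no x≢0   = trans (cong (_∨ elem x s) (==-≢ x≢0)) x∉ ∷ ∨-conicalʳ (zero == x) _ 0∉ ∷ nd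
nodup-take-out {m} (suc j) (x ∷ s) (x∉ ∷ nd) 0∉ (s≤s j<s)
  with nodup-take-out j s nd (∨-conicalʳ (zero == x) _ 0∉) j<s
... | y∉ ∷ nd′ = y∉′ ∷ x∉′ ∷ nd′
  where
  y : Fin (suc m)
  y = nthOr s j zero
  y≢x : ¬ (y ≡ x)
  y≢x refl = true≢false (trans (sym (nthOr-elem s j zero j<s)) x∉)
  y∉′ : (y == x) ∨ elem y (putZero j s) ≡ false
  y∉′ rewrite ==-≢ y≢x = y∉
  x∉′ : elem x (putZero j s) ≡ false
  x∉′ with elem x (putZero j s) in x∈
  ... | false = refl
  ... | true with elem-putZero x j s x∈
  ...   | inj₂ x∈s  = ⊥-elim (true≢false (trans (sym x∈s) x∉))
  ...   | inj₁ refl = ⊥-elim (true≢false 0∉)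

nodup-insertZero : {m : ℕ} (j : ℕ) (g : List (Fin m)) → Nodup g → Nodup (insertZero j (map suc g))
nodup-insertZero zero    g       nd        = elem-zero-map-suc g ∷ nodup-map-suc nd
nodup-insertZero (suc j) []      nd        = refl ∷ []
nodup-insertZero (suc j) (x ∷ g) (x∉ ∷ nd) = fresh j g x∉ ∷ nodup-insertZero j g nd
  where
  fresh : ∀ j g → elem x g ≡ false → elem (suc x) (insertZero j (map suc g)) ≡ false
  fresh zero    g       x∉ = trans (elem-map-suc x g) x∉
  fresh (suc j) []      x∉ = refl
  fresh (suc j) (y ∷ g) x∉ rewrite ==-suc x y with x == y
  ... | false = fresh j g x∉

nodup-∷ʳ : {n : ℕ} (l : List (Fin n)) (a : Fin n) → Nodup (l ++ [ a ]) → Nodup (a ∷ l)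
nodup-∷ʳ l a nd = a∉ l nd ∷ init l nd
  where
  init : (l : List _) → Nodup (l ++ [ a ]) → Nodup l
  init []      _         = []
  init (x ∷ l) (x∉ ∷ nd) = ∨-conicalˡ (elem x l) _ (trans (sym (elem-++ x l [ a ])) x∉) ∷ init l nd
  a∉ : (l : List _) → Nodup (l ++ [ a ]) → elem a l ≡ false
  a∉ []      _         = refl
  a∉ (x ∷ l) (x∉ ∷ nd) with a ≟ x
  ... | yes refl = ⊥-elim (true≢false (trans (sym (trans (elem-++ a l [ a ]) (∨-zeroʳ′ (elem a l)))) x∉))
    where ∨-zeroʳ′ : ∀ c → c ∨ ((a == a) ∨ false) ≡ true
          ∨-zeroʳ′ c rewrite ==-refl a = ∨-zeroʳ c
  ... | no _     = a∉ l nd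

nodup-rotate : {n : ℕ} {l : List (Fin n)} → Nodup l → Nodup (rotate l)
nodup-rotate {l = []}    nd = nd
nodup-rotate {l = a ∷ l} nd = nodup-∷ʳ (initOf a l) (lastOf a l) (subst Nodup (sym (initOf-lastOf a l)) nd)

record Uncontracted {n : ℕ} (d : List (Fin (suc (suc n)))) (g : List (Fin (suc n))) (m : Maybe ℕ) : Set where
  constructor uncontracted
  field
    u         : Fin (suc n)
    xs        : List (Fin (suc (suc n)))
    d≡        : d ≡ suc u ∷ xs
    contract≡ : contract u xs ≡ g
    zeroAt≡   : zeroAt xs ≡ m

Admissible : Maybe ℕ → ℕ → Set
Admissible nothing  k = 0 < k
Admissible (just j) k = j < k

uncontract-shape : {n : ℕ} (g : List (Fin (suc n))) (m : Maybe ℕ) → Admissible m (length g) → Uncontracted (uncontract g m) g m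
uncontract-shape (a ∷ l) nothing _ =
  uncontracted (lastOf a l) (map suc (initOf a l))
    (cong₂ _∷_ (lastOf-map suc a l) (initOf-map suc a l))
    contracted
    (zeroAt-map-suc (initOf a l))
  where
  contracted : contract (lastOf a l) (map suc (initOf a l)) ≡ a ∷ l
  contracted rewrite zeroAt-map-suc (initOf a l)
                   | map-++ (collapse (lastOf a l)) (map suc (initOf a l)) [ zero ]
                   | map-collapse-suc (lastOf a l) (initOf a l) = initOf-lastOf a l
uncontract-shape g (just j) j<g with collapse-putZero g j (nthOr g j zero) j<g refl
... | entry , restored , zero-at =
  uncontracted (nthOr g j zero) (putZero j (map suc g)) (cong (_∷ putZero j (map suc g)) entry)
    contracted zero-at
  where
  contracted : contract (nthOr g j zero) (putZero j (map suc g)) ≡ g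
  contracted rewrite zero-at | ++-identityʳ (putZero j (map suc g)) = restored

nodup-uncontract : {n : ℕ} (g : List (Fin (suc n))) (m : Maybe ℕ) → Admissible m (length g) →
  Nodup g → Nodup (uncontract g m)
nodup-uncontract g nothing  _   nd = nodup-rotate (nodup-map-suc nd)
nodup-uncontract g (just j) j<g nd =
  nodup-take-out j (map suc g) (nodup-map-suc nd) (elem-zero-map-suc g) (subst (j <_) (sym (length-map suc g)) j<g)

toGood-length : (n : ℕ) (f : List (Fin n)) → Nodup f → length (toGood n f) ≡ suc (length f)
toGood-length zero    []  _  = refl
toGood-length (suc n) f   nd with zeroAt f in at
... | nothing = begin
  length (rotate (map suc g))    ≡⟨ length-rotate (map suc g) ⟩
  length (map suc g)             ≡⟨ length-map suc g ⟩
  length g                       ≡⟨ toGood-length n (lower f) (nodup-lower nd) ⟩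
  suc (length (lower f))         ≡⟨ cong suc (length-lower-nothing f at) ⟩
  suc (length f)                 ∎
  where open ≡-Reasoning
        g : List (Fin (suc n))
        g = toGood n (lower f)
... | just j = cong suc (begin
  length (putZero j (map suc g)) ≡⟨ length-putZero j (map suc g) ⟩
  length (map suc g)             ≡⟨ length-map suc g ⟩
  length g                       ≡⟨ toGood-length n (lower f) (nodup-lower nd) ⟩
  suc (length (lower f))         ≡⟨ length-lower-just f j at nd ⟩
  length f                       ∎)
  where open ≡-Reasoning
        g : List (Fin (suc n))
        g = toGood n (lower f)

admissible-zeroAt : (n : ℕ) (f : List (Fin (suc n))) → Nodup f → Admissible (zeroAt f) (length (toGood n (lower f)))
admissible-zeroAt n f nd with zeroAt f in at
... | nothing = subst (0 <_) (sym (toGood-length n (lower f) (nodup-lower nd))) (s≤s z≤n)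
... | just j  = subst (j <_) (sym (trans (toGood-length n (lower f) (nodup-lower nd)) (length-lower-just f j at nd)))
                      (zeroAt-just-< f j at)

toGood-shape : (n : ℕ) (f : List (Fin (suc n))) → Nodup f →
  Uncontracted (toGood (suc n) f) (toGood n (lower f)) (zeroAt f)
toGood-shape n f nd = uncontract-shape (toGood n (lower f)) (zeroAt f) (admissible-zeroAt n f nd)

nodup-toGood : (n : ℕ) (f : List (Fin n)) → Nodup f → Nodup (toGood n f)
nodup-toGood zero    [] _  = refl ∷ []
nodup-toGood (suc n) f  nd =
  nodup-uncontract (toGood n (lower f)) (zeroAt f) (admissible-zeroAt n f nd) (nodup-toGood n (lower f) (nodup-lower nd))

uncontract-contract : {n : ℕ} (u : Fin (suc n)) (xs : List (Fin (suc (suc n)))) → Nodup xs →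
  uncontract (contract u xs) (zeroAt xs) ≡ suc u ∷ xs
uncontract-contract u xs nd with zeroAt xs in at
... | nothing = begin
  rotate (map suc (map (collapse u) (xs ++ [ zero ])))
    ≡⟨ cong (rotate ∘ map suc) (map-++ (collapse u) xs [ zero ]) ⟩
  rotate (map suc (map (collapse u) xs ++ [ u ]))
    ≡⟨ cong rotate (map-++ suc (map (collapse u) xs) [ u ]) ⟩
  rotate (map suc (map (collapse u) xs) ++ [ suc u ])
    ≡⟨ cong (λ l → rotate (l ++ [ suc u ])) (map-suc-collapse u xs (zeroAt-nothing-elem xs at)) ⟩
  rotate (xs ++ [ suc u ])
    ≡⟨ rotate-++ xs (suc u) ⟩
  suc u ∷ xs
    ∎
  where open ≡-Reasoning
... | just j rewrite ++-identityʳ xs with uncollapse-at u xs j at nd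
...   | entry , restored = cong₂ _∷_ entry restored

lower-insertZero? : {n : ℕ} (m : Maybe ℕ) (g : List (Fin n)) → lower (insertZero? m (map suc g)) ≡ g
lower-insertZero? nothing  g = lower-map-suc g
lower-insertZero? (just j) g = lower-insertZero g j

zeroAt-insertZero? : {n : ℕ} (m : Maybe ℕ) (g : List (Fin n)) → Admissible m (suc (length g)) →
  zeroAt (insertZero? m (map suc g)) ≡ m
zeroAt-insertZero? nothing  g _         = zeroAt-map-suc g
zeroAt-insertZero? (just j) g (s≤s j≤g) = zeroAt-insertZero g j j≤g

nodup-insertZero? : {n : ℕ} (m : Maybe ℕ) {g : List (Fin n)} → Nodup g → Nodup (insertZero? m (map suc g))
nodup-insertZero? nothing      nd = nodup-map-suc nd
nodup-insertZero? (just j) {g} nd = nodup-insertZero j g nd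

insertZero?-lower : {n : ℕ} (f : List (Fin (suc n))) → Nodup f → insertZero? (zeroAt f) (map suc (lower f)) ≡ f
insertZero?-lower f nd with zeroAt f in at
... | nothing = zeroAt-nothing f at
... | just j  = zeroAt-just f j at nd

good-toGood : (n : ℕ) (f : List (Fin n)) → Nodup f → Good (toGood n f)
good-toGood zero    f nd zero zero = 0 , refl
good-toGood (suc n) f nd with toGood-shape n f nd
... | uncontracted u xs d≡ contract≡ _ =
  subst Good (sym d≡) (contract-good (subst Nodup d≡ (nodup-toGood (suc n) f nd))
                                     (subst Good (sym contract≡) (good-toGood n (lower f) (nodup-lower nd))))
  where open GoodContract u xs

fromGood-toGood : (n : ℕ) (f : List (Fin n)) → Nodup f → fromGood n (toGood n f) ≡ f
fromGood-toGood zero    [] _  = refl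
fromGood-toGood (suc n) f  nd with toGood-shape n f nd
... | uncontracted u xs d≡ contract≡ zeroAt≡ rewrite d≡ | zeroAt≡ | contract≡
    | fromGood-toGood n (lower f) (nodup-lower nd) = insertZero?-lower f nd

elem-nonempty : {n : ℕ} (v : Fin n) (l : List (Fin n)) → elem v l ≡ true → 0 < length l
elem-nonempty v []      ()
elem-nonempty v (x ∷ l) _ = s≤s z≤n

nodup-contract : {n : ℕ} (u : Fin (suc n)) (xs : List (Fin (suc (suc n)))) → Nodup (suc u ∷ xs) → Nodup (contract u xs)
nodup-contract u xs (su∉ ∷ nd) =
  nodup-map-collapse u (xs ++ zeroIfAbsent xs) nodup-with-zero (trans (elem-suc-zeroIfAbsent u xs) su∉)
  where
  nodup-with-zero : Nodup (xs ++ zeroIfAbsent xs)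
  nodup-with-zero with zeroAt xs in at
  ... | nothing = nodup-++ nd (refl ∷ []) (λ v v∈ → fresh v v∈)
    where
    fresh : ∀ v → elem v xs ≡ true → elem v [ zero ] ≡ false
    fresh v v∈ with v ≟ zero
    ... | yes refl = ⊥-elim (true≢false (trans (sym v∈) (zeroAt-nothing-elem xs at)))
    ... | no _     = refl
  ... | just j = subst Nodup (sym (++-identityʳ xs)) nd

u∈contract : {n : ℕ} (u : Fin (suc n)) (xs : List (Fin (suc (suc n)))) → elem u (contract u xs) ≡ true
u∈contract u xs rewrite elem-map-collapse u u (xs ++ zeroIfAbsent xs) | elem-zero-zeroIfAbsent xs | ==-refl u = refl

admissible-contract : {n : ℕ} (u : Fin (suc n)) (xs : List (Fin (suc (suc n)))) →
  Admissible (zeroAt xs) (length (contract u xs))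
admissible-contract u xs = admissible (zeroAt xs) refl
  where
  admissible : (m : Maybe ℕ) → zeroAt xs ≡ m → Admissible m (length (contract u xs))
  admissible nothing  _  = elem-nonempty u (contract u xs) (u∈contract u xs)
  admissible (just j) at = subst (j <_) (sym (begin
    length (contract u xs)                   ≡⟨ length-map (collapse u) (xs ++ zeroIfAbsent xs) ⟩
    length (xs ++ zeroIfAbsent xs)           ≡⟨ cong (λ m → length (xs ++ maybe′ (λ _ → []) [ zero ] m)) at ⟩
    length (xs ++ [])                        ≡⟨ cong length (++-identityʳ xs) ⟩
    length xs                                ∎)) (zeroAt-just-< xs j at)
    where open ≡-Reasoning

toGood-fromGood : (n : ℕ) (d : List (Fin (suc n))) → Nodup d → Good d → 0 < length d →
  Nodup (fromGood n d) × toGood n (fromGood n d) ≡ d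
toGood-fromGood zero    (zero ∷ [])       _           _    _ = [] , refl
toGood-fromGood zero    (zero ∷ zero ∷ _) (() ∷ _)    _    _
toGood-fromGood (suc n) (zero ∷ xs)       _           good _ = ⊥-elim (not-good-zero∷ xs good)
toGood-fromGood (suc n) (suc u ∷ xs)      nd@(_ ∷ nd-xs) good _ =
  nodup-insertZero? (zeroAt xs) nd-g , rebuilt
  where
  open GoodContract u xs
  dm : List (Fin (suc n))
  dm = contract u xs
  IH : Nodup (fromGood n dm) × toGood n (fromGood n dm) ≡ dm
  IH = toGood-fromGood n dm (nodup-contract u xs nd) (good-contract good)
         (elem-nonempty u dm (u∈contract u xs))
  g : List (Fin n)
  g = fromGood n dm
  nd-g : Nodup g
  nd-g = proj₁ IH
  admissible : Admissible (zeroAt xs) (suc (length g))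
  admissible = subst (Admissible (zeroAt xs))
                     (trans (cong length (sym (proj₂ IH))) (toGood-length n g nd-g)) (admissible-contract u xs)
  rebuilt : toGood (suc n) (insertZero? (zeroAt xs) (map suc g)) ≡ suc u ∷ xs
  rebuilt = begin
    uncontract (toGood n (lower (insertZero? (zeroAt xs) (map suc g)))) (zeroAt (insertZero? (zeroAt xs) (map suc g)))
      ≡⟨ cong₂ (λ l m → uncontract (toGood n l) m)
               (lower-insertZero? (zeroAt xs) g) (zeroAt-insertZero? (zeroAt xs) g admissible) ⟩
    uncontract (toGood n g) (zeroAt xs)   ≡⟨ cong (λ l → uncontract l (zeroAt xs)) (proj₂ IH) ⟩
    uncontract dm (zeroAt xs)             ≡⟨ uncontract-contract u xs nd-xs ⟩
    suc u ∷ xs                            ∎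
    where open ≡-Reasoning

allVecs : (b n : ℕ) → List (Vec (Fin b) n)
allVecs b zero    = [] ∷ []
allVecs b (suc n) = cartesianProductWith _∷_ (allFin b) (allVecs b n)

unique-allVecs : (b n : ℕ) → Unique (allVecs b n)
unique-allVecs b zero    = All.[] ∷ []
unique-allVecs b (suc n) = cartesianProductWith⁺ _∷_ ∷-injective (allFin⁺ b) (unique-allVecs b n)

∈-allVecs : (b n : ℕ) (v : Vec (Fin b) n) → v ∈ allVecs b n
∈-allVecs b zero    []      = here refl
∈-allVecs b (suc n) (x ∷ v) = ∈-cartesianProductWith⁺ _∷_ (∈-allFin x) (∈-allVecs b n v)

length-cartesianProductWith : {A B C : Set} (f : A → B → C) (xs : List A) (ys : List B) →
  length (cartesianProductWith f xs ys) ≡ length xs * length ys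
length-cartesianProductWith f []       ys = refl
length-cartesianProductWith f (x ∷ xs) ys =
  trans (length-++ (map (f x) ys)) (cong₂ _+_ (length-map (f x) ys) (length-cartesianProductWith f xs ys))

length-allVecs : (b n : ℕ) → length (allVecs b n) ≡ b ^ n
length-allVecs b zero    = refl
length-allVecs b (suc n) = trans (length-cartesianProductWith _∷_ (allFin b) (allVecs b n))
  (cong₂ _*_ (length-tabulate {n = b} (λ (i : Fin b) → i)) (length-allVecs b n))

-- Distinct-label lists starting with 0 correspond to good lists of the same
-- length: drop the 0, lower the rest, and apply toGood; conversely apply fromGood.
module Correspondence (b : ℕ) where

  goodOf : List (Fin (suc b)) → List (Fin (suc b))
  goodOf []      = []
  goodOf (_ ∷ t) = toGood b (lower t)

  zeroStart : List (Fin (suc b)) → List (Fin (suc b))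
  zeroStart d = zero ∷ map suc (fromGood b d)

  module _ (t : List (Fin (suc b))) (nd : Nodup (zero ∷ t)) where
    private
      nd-lower : Nodup (lower t)
      nd-lower = nodup-lower (nodup-tail nd)
      no-zero : zeroAt t ≡ nothing
      no-zero = zeroAt-elem t (head-fresh nd)

    nodup-goodOf : Nodup (goodOf (zero ∷ t))
    nodup-goodOf = nodup-toGood b (lower t) nd-lower

    good-goodOf : Good (goodOf (zero ∷ t))
    good-goodOf = good-toGood b (lower t) nd-lower

    length-goodOf : length (zero ∷ t) ≡ length (goodOf (zero ∷ t))
    length-goodOf = sym (trans (toGood-length b (lower t) nd-lower) (cong suc (length-lower-nothing t no-zero)))

    zeroStart-goodOf : zeroStart (goodOf (zero ∷ t)) ≡ zero ∷ t
    zeroStart-goodOf = cong (zero ∷_) (trans (cong (map suc) (fromGood-toGood b (lower t) nd-lower)) (zeroAt-nothing t no-zero))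

  module _ (d : List (Fin (suc b))) (nd : Nodup d) (good : Good d) (nonempty : 0 < length d) where
    private
      f : List (Fin b)
      f = fromGood b d
      inverse : Nodup f × toGood b f ≡ d
      inverse = toGood-fromGood b d nd good nonempty

    nodup-zeroStart : Nodup (zeroStart d)
    nodup-zeroStart = elem-zero-map-suc f ∷ nodup-map-suc (proj₁ inverse)

    length-zeroStart : length d ≡ length (zeroStart d)
    length-zeroStart = trans (cong length (sym (proj₂ inverse)))
      (trans (toGood-length b f (proj₁ inverse)) (cong suc (sym (length-map suc f))))

    goodOf-zeroStart : goodOf (zeroStart d) ≡ d
    goodOf-zeroStart = trans (cong (toGood b) (lower-map-suc f)) (proj₂ inverse)

-- The bijection between arbitrary sequences of length n and full-cycle card
-- sequences of length n + 1: prepend the label 0, then rename the labels so that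
-- their distinct list becomes the corresponding good list.
module FullCycles (b n : ℕ) where
  open Correspondence b

  toFull : Vec (Fin (suc b)) n → Vec (Fin (suc b)) (suc n)
  toFull w = levels (relabelTo (goodOf (distinct (zero ∷ w))) (zero ∷ w))

  fromFull : Vec (Fin (suc b)) (suc n) → Vec (Fin (suc b)) n
  fromFull A = Vec.tail (relabelTo (zeroStart (distinct (labels A))) (labels A))

  module _ (w : Vec (Fin (suc b)) n) where
    private
      t : List (Fin (suc b))
      t = remove zero (distinct w)
      e : List (Fin (suc b))
      e = zero ∷ t
      nd : Nodup e
      nd = nodup-distinct (zero ∷ w)
      y : Vec (Fin (suc b)) (suc n)
      y = relabelTo (goodOf e) (zero ∷ w)
      distinct-y : distinct y ≡ goodOf e
      distinct-y = distinct-relabelTo (goodOf e) (zero ∷ w) (nodup-goodOf t nd) (length-goodOf t nd)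

    full-toFull : IsFullCycle (permOf (toFull w))
    full-toFull = full-cong (λ q → sym (trans (permOf-levels y q) (cong (λ d → at (complete d) q) distinct-y)))
                            (good-goodOf t nd)

    fromFull-toFull : fromFull (toFull w) ≡ w
    fromFull-toFull = cong Vec.tail (begin
      relabelTo (zeroStart (distinct (labels (levels y)))) (labels (levels y))
        ≡⟨ cong (λ z → relabelTo (zeroStart (distinct z)) z) (labels-levels y) ⟩
      relabelTo (zeroStart (distinct y)) y   ≡⟨ cong (λ d → relabelTo (zeroStart d) y) distinct-y ⟩
      relabelTo (zeroStart (goodOf e)) y     ≡⟨ cong (λ d → relabelTo d y) (zeroStart-goodOf t nd) ⟩
      relabelTo e y
        ≡⟨ relabelTo-relabelTo (goodOf e) (zero ∷ w) (nodup-goodOf t nd) (length-goodOf t nd) ⟩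
      zero ∷ w                               ∎)
      where open ≡-Reasoning

  -- On full cycles toFull undoes fromFull: the renamed labels of A start with 0.
  toFull-fromFull : (A : Vec (Fin (suc b)) (suc n)) → IsFullCycle (permOf A) → toFull (fromFull A) ≡ A
  toFull-fromFull A full = begin
    levels (relabelTo (goodOf (distinct (zero ∷ fromFull A))) (zero ∷ fromFull A))
      ≡⟨ cong (λ z → levels (relabelTo (goodOf (distinct z)) z)) (sym x≡0∷) ⟩
    levels (relabelTo (goodOf (distinct x)) x)  ≡⟨ cong (λ d → levels (relabelTo (goodOf d) x)) distinct-x ⟩
    levels (relabelTo (goodOf e) x)             ≡⟨ cong (λ d → levels (relabelTo d x)) (goodOf-zeroStart d nd good nonempty) ⟩
    levels (relabelTo d x)
      ≡⟨ cong levels (relabelTo-relabelTo e y (nodup-zeroStart d nd good nonempty)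
                                              (length-zeroStart d nd good nonempty)) ⟩
    levels y                                    ≡⟨ levels-labels A ⟩
    A                                           ∎
    where
    open ≡-Reasoning
    y : Vec (Fin (suc b)) (suc n)
    y = labels A
    d e : List (Fin (suc b))
    d = distinct y
    e = zeroStart d
    x : Vec (Fin (suc b)) (suc n)
    x = relabelTo e y
    nd : Nodup d
    nd = nodup-distinct y
    good : Good d
    good = full-cong (permOf-arrangement A) full
    nonempty : 0 < length d
    nonempty = nonempty-distinct y
    distinct-x : distinct x ≡ e
    distinct-x = distinct-relabelTo e y (nodup-zeroStart d nd good nonempty) (length-zeroStart d nd good nonempty)
    x≡0∷ : x ≡ zero ∷ fromFull A
    x≡0∷ = head-distinct x distinct-x

theorem6p1 : (b n : ℕ) → 1 ≤ b → 1 ≤ n →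
    Σ (List (Vec (Fin b) n)) λ L →
      Unique L × ((A : Vec (Fin b) n) → (A ∈ L ⇔ IsFullCycle (permOf A))) ×
      length L * b ≡ b ^ n
theorem6p1 zero    n       () _
theorem6p1 (suc b) zero    _  ()
theorem6p1 (suc b) (suc n) _  _ = L , unique , (λ A → mk⇔ (full A) (listed A)) , count
  where
  open FullCycles b n
  L : List (Vec (Fin (suc b)) (suc n))
  L = map toFull (allVecs (suc b) n)

  unique : Unique L
  unique = map⁺ (λ {w} {w′} eq → trans (sym (fromFull-toFull w)) (trans (cong fromFull eq) (fromFull-toFull w′)))
                (unique-allVecs (suc b) n)

  full : (A : Vec (Fin (suc b)) (suc n)) → A ∈ L → IsFullCycle (permOf A)
  full A A∈L with ∈-map⁻ toFull A∈L
  ... | w , _ , refl = full-toFull w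

  listed : (A : Vec (Fin (suc b)) (suc n)) → IsFullCycle (permOf A) → A ∈ L
  listed A fullA = subst (_∈ L) (toFull-fromFull A fullA) (∈-map⁺ toFull (∈-allVecs (suc b) n (fromFull A)))

  count : length L * suc b ≡ suc b ^ suc n
  count = trans (cong (_* suc b) (trans (length-map toFull (allVecs (suc b) n)) (length-allVecs (suc b) n)))
                (*-comm (suc b ^ n) (suc b))
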